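{- Let $I=(A,\succ,c)$ be an SF instance, let $\Pi$ be a GSP of $I$, and let $\Pi_i=(a_{i_1}\ a_{i_2}\ \dots\ a_{i_k})\in\Pi$ be a cycle of even length $k$. Then $\Pi'=(\Pi\setminus\{\Pi_i\})\cup\{(a_{i_1}\ a_{i_2}),(a_{i_3}\ a_{i_4}),\dots,(a_{i_{k-1}}\ a_{i_k})\}$ and $\Pi''=(\Pi\setminus\{\Pi_i\})\cup\{(a_{i_1}\ a_{i_k}),(a_{i_2}\ a_{i_3}),\dots,(a_{i_{k-2}}\ a_{i_{k-1}})\}$ are both GSPs of $I$.
   Context: A Stable Fixtures (SF) instance is $I=(A,\succ,c)$ where $A=\{a_1,\dots,a_n\}$ is a finite set of $n$ agents; each agent $a_i$ has a strict linear order $\succ_i$ over $A\setminus\{a_i\}$ (complete preference list), with the convention that every agent ranks itself last ($a_j\succ_i a_i$ for all $j\neq i$); $a\succeq_i b$ means $a\succ_i b$ or $a=b$. Each agent has an integer capacity $c_i$ with $1\le c_i<n$. A cyclic permutation of a nonempty set $A_r\subseteq A$ is a permutation $\Pi_r$ of $A_r$ consisting of a single cycle of length $|A_r|$ (length 1: a fixed point $(a_i)$; length 2: a transposition $(a_i\ a_j)$). Two cyclic permutations are distinct if some element is mapped to different elements by them. A GSP (generalised stable partition) of $I$ is a finite collection $\Pi=\{\Pi_1,\dots,\Pi_k\}$ of cyclic permutations $\Pi_r$ of sets $A_r\subseteq A$, pairwise distinct except that fixed points may be repeated, such that: (F1) for every $r$ and every $a_j\in A_r$, $\Pi_r(a_j)\succeq_j\Pi_r^{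 -1}(a_j)$; (F2) there are no distinct $a_i,a_j\in A$ with the transposition $(a_i\ a_j)\notin\Pi$ such that $a_j\succ_i\Pi_r^{ -1}(a_i)$ and $a_i\succ_j\Pi_s^{ -1}(a_j)$ for some $\Pi_r,\Pi_s\in\Pi$ with $a_i\in A_r$, $a_j\in A_s$; (F3) for every $a_i\in A$, the number of indices $r$ with $a_i\in A_r$ equals $c_i$; (F4) for all distinct $a_i,a_j\in A$, $|\{s:\Pi_s(a_i)=a_j\}|+|\{s:\Pi_s(a_j)=a_i\}|\le 2$. -}

module Defs where

open import Data.Nat using (ℕ; zero; suc; _+_; _*_; _≤_; _<_)
open import Data.Fin using (Fin)
open import Data.Fin.Properties using () renaming (_≟_ to _≟ᶠ_)
open import Data.List using (List; []; _∷_; length; filter; _++_; removeAt; lookup)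
open import Data.List.Membership.Propositional using (_∈_)
import Data.List.Membership.DecPropositional as DecMem
open import Data.List.Relation.Unary.Unique.Propositional using (Unique)
open import Data.List.Relation.Unary.Any using (Any)
open import Data.Product using (Σ; ∃; ∃-syntax; _×_; _,_)
open import Data.Product.Properties using (≡-dec)
open import Data.Sum using (_⊎_)
open import Function.Definitions using (Injective)
open import Relation.Binary.PropositionalEquality using (_≡_; _≢_)
open import Relation.Nullary using (¬_)

-- SF instances.  Agents are Fin n.  The preference list of agent i is
-- encoded by an injective rank function (smaller rank = more preferred)
-- in which i itself has the worst rank.

record SFInstance : Set where
  field
    n        : ℕ
    rank     : Fin n → Fin n → ℕ
    rank-inj : ∀ i → Injective _≡_ _≡_ (rank i)
    self-last : ∀ i j → j ≢ i → rank i j < rank i i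
    cap      : Fin n → ℕ
    cap-pos  : ∀ i → 1 ≤ cap i
    cap-lt-n : ∀ i → cap i < n

module _ (I : SFInstance) where
  open SFInstance I

  Agent : Set
  Agent = Fin n

  Prefers : Agent → Agent → Agent → Set
  Prefers i a b = rank i a < rank i b

  PrefersEq : Agent → Agent → Agent → Set
  PrefersEq i a b = Prefers i a b ⊎ a ≡ b

-- Cyclic permutations, represented by a nonempty duplicate-free list
-- (a₁ a₂ … a_k) in cycle order: aₜ ↦ aₜ₊₁ and a_k ↦ a₁.

module _ {A : Set} where

  private
    go : A → List A → List (A × A)
    go f []           = []
    go f (y ∷ [])     = (y , f) ∷ []
    go f (y ∷ z ∷ zs) = (y , z) ∷ go f (z ∷ zs)

  succPairs : List A → List (A × A)
  succPairs []       = []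
  succPairs (x ∷ xs) = go x (x ∷ xs)

  MapsTo : List A → A → A → Set
  MapsTo C a b = (a , b) ∈ succPairs C

  IsCycle : List A → Set
  IsCycle C = (1 ≤ length C) × Unique C

  IsFixedPoint : List A → Set
  IsFixedPoint C = length C ≡ 1

  IsTransposition : List A → A → A → Set
  IsTransposition C a b = (C ≡ a ∷ b ∷ []) ⊎ (C ≡ b ∷ a ∷ [])

  DistinctCycles : List A → List A → Set
  DistinctCycles C D =
    ∃[ a ] ∃[ b ] ((MapsTo C a b × ¬ MapsTo D a b) ⊎ (MapsTo D a b × ¬ MapsTo C a b))

  pairsA : List A → List (List A)
  pairsA []           = []
  pairsA (x ∷ [])     = []
  pairsA (x ∷ y ∷ zs) = (x ∷ y ∷ []) ∷ pairsA zs

  private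
    lastOr : A → List A → A
    lastOr d []       = d
    lastOr d (y ∷ ys) = lastOr y ys

    dropLast : List A → List A
    dropLast []           = []
    dropLast (y ∷ [])     = []
    dropLast (y ∷ z ∷ zs) = y ∷ dropLast (z ∷ zs)

  pairsB : List A → List (List A)
  pairsB []       = []
  pairsB (x ∷ xs) = (x ∷ lastOr x xs ∷ []) ∷ pairsA (dropLast xs)

module _ (I : SFInstance) where
  open SFInstance I

  Cycle : Set
  Cycle = List (Fin n)

  occurrences : List Cycle → Fin n → ℕ
  occurrences Π a = length (filter (λ C → DecMem._∈?_ _≟ᶠ_ a C) Π)

  mapCount : List Cycle → Fin n → Fin n → ℕ
  mapCount Π a b =
    length (filter (λ C → DecMem._∈?_ (≡-dec _≟ᶠ_ _≟ᶠ_) (a , b) (succPairs C)) Π)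

  Blocks : List Cycle → Fin n → Fin n → Set
  Blocks Π i j =
    (∃[ C ] (C ∈ Π) × ∃[ p ] (MapsTo C p i × Prefers I i j p)) ×
    (∃[ D ] (D ∈ Π) × ∃[ q ] (MapsTo D q j × Prefers I j i q))

  record IsGSP (Π : List Cycle) : Set where
    field
      cycles   : ∀ C → C ∈ Π → IsCycle C
      distinct : ∀ (r s : Fin (length Π)) → r ≢ s →
                 (IsFixedPoint (lookup Π r) × IsFixedPoint (lookup Π s))
                 ⊎ DistinctCycles (lookup Π r) (lookup Π s)
      F1 : ∀ C → C ∈ Π → ∀ a b p → MapsTo C a b → MapsTo C p a →
           PrefersEq I a b p
      F2 : ∀ i j → i ≢ j →
           (∀ C → C ∈ Π → ¬ IsTransposition C i j) →
           ¬ Blocks Π i j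
      F3 : ∀ a → occurrences Π a ≡ cap a
      F4 : ∀ a b → a ≢ b → mapCount Π a b + mapCount Π b a ≤ 2

-- Splitting an even cycle C of a GSP into alternate transpositions keeps every agent's
-- number of memberships, and each agent's new partner is one of its two neighbours in C,
-- which by (F1) it likes at least as much as its predecessor in C; so no new blocking pair
-- appears. The real content is that no other member of the partition uses an edge of C,
-- which gives (F4) and distinctness for the new transpositions. When C or the other member
-- is a transposition this is (F4) itself. For two cycles of length at least 3 it is
-- stability: if x had different predecessors p and q in two such cycles, preferring p, then
-- x and p would block, since p likes its successor x better than its own predecessor. So
-- long cycles sharing an agent have the same predecessors along the whole cycle, hence the
-- same edges, contradicting their distinctness.

module Submission where

open import Defs
open import Data.Nat using (ℕ; zero; suc; _+_; _*_; _≤_; z≤n; s≤s)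
open import Data.Nat.Properties
  using ( suc-injective; *-suc; +-comm; +-identityʳ; +-mono-≤
        ; ≤-trans; ≤-reflexive; <-trans; <-cmp; ≤⇒≯; n≤1+n; m≤n+m)
open import Data.Fin using (Fin; zero; suc)
open import Data.Fin.Properties using () renaming (_≟_ to _≟ᶠ_)
open import Data.List using (List; []; _∷_; [_]; _++_; length; drop; filter; lookup; removeAt)
open import Data.List.Properties
  using ( filter-++; length-++; filter-some; filter-none; filter-accept; filter-reject
        ; length-filter; tabulate-lookup)
open import Data.List.Membership.Propositional using (_∈_; _∉_; lose)
open import Data.List.Membership.Propositional.Properties using (∈-++⁺ˡ; ∈-++⁺ʳ; ∈-++⁻; ∈-lookup)
import Data.List.Membership.DecPropositional as DecMem
open import Data.List.Relation.Unary.Any using (here; there)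
open import Data.List.Relation.Unary.All as All using (All; []; _∷_)
open import Data.List.Relation.Unary.AllPairs using (AllPairs; []; _∷_)
import Data.List.Relation.Unary.AllPairs.Properties as AllPairs
open import Data.List.Relation.Unary.Unique.Propositional using (Unique)
open import Data.List.Relation.Unary.Unique.Propositional.Properties using (Unique[x∷xs]⇒x∉xs)
open import Data.List.Relation.Binary.Permutation.Propositional as ↭
  using (_↭_; ↭-refl; ↭-prep; ↭-swap; ↭-trans; ↭-sym; ↭-reflexive)
open import Data.List.Relation.Binary.Permutation.Propositional.Properties
  using (All-resp-↭; ∈-resp-↭; filter-↭; ↭-length; ∷↭∷ʳ)
open import Data.Product using (∃-syntax; _×_; _,_; proj₁; proj₂)
open import Data.Product.Properties using (≡-dec)
open import Data.Sum using (_⊎_; inj₁; inj₂; [_,_]′)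
open import Data.Empty using (⊥-elim)
open import Function using (_∘_)
open import Relation.Nullary using (¬_; Dec; yes; no)
open import Relation.Nullary.Decidable using (_⊎-dec_)
open import Relation.Unary using (Decidable)
open import Relation.Binary using (Symmetric; tri<; tri≈; tri>)
open import Relation.Binary.PropositionalEquality
  using (_≡_; _≢_; refl; sym; trans; cong; cong₂; subst; ≢-sym; module ≡-Reasoning)

-- Cycles as duplicate-free lists

module _ {A : Set} where

  consecutive : List A → List (A × A)
  consecutive (x ∷ y ∷ ys) = (x , y) ∷ consecutive (y ∷ ys)
  consecutive _            = []

  lastOr : A → List A → A
  lastOr x []       = x
  lastOr x (y ∷ ys) = lastOr y ys

  dropLast : List A → List A
  dropLast (x ∷ y ∷ ys) = x ∷ dropLast (y ∷ ys)
  dropLast _            = []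

  Adjacent : List A → A → A → Set
  Adjacent C u v = MapsTo C u v ⊎ MapsTo C v u

  Adjacent-sym : ∀ (C : List A) {u v} → Adjacent C u v → Adjacent C v u
  Adjacent-sym _ (inj₁ m) = inj₂ m
  Adjacent-sym _ (inj₂ m) = inj₁ m

  -- The worker behind succPairs is private to Defs; it is reached as the tail of
  -- succPairs (f ∷ y ∷ ys).
  private
    succPairs-tail : ∀ f y ys →
      drop 1 (succPairs (f ∷ y ∷ ys)) ≡ consecutive (y ∷ ys) ++ [ (lastOr y ys , f) ]
    succPairs-tail f y []       = refl
    succPairs-tail f y (z ∷ zs) = cong ((y , z) ∷_) (succPairs-tail f z zs)

  succPairs-∷ : ∀ x xs → succPairs (x ∷ xs) ≡ consecutive (x ∷ xs) ++ [ (lastOr x xs , x) ]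
  succPairs-∷ x []       = refl
  succPairs-∷ x (y ∷ ys) = cong ((x , y) ∷_) (succPairs-tail x y ys)

  consecutive⇒MapsTo : ∀ {x xs a b} → (a , b) ∈ consecutive (x ∷ xs) → MapsTo (x ∷ xs) a b
  consecutive⇒MapsTo {x} {xs} p = subst (_ ∈_) (sym (succPairs-∷ x xs)) (∈-++⁺ˡ p)

  MapsTo-lastOr : ∀ {x xs} → MapsTo (x ∷ xs) (lastOr x xs) x
  MapsTo-lastOr {x} {xs} =
    subst ((lastOr x xs , x) ∈_) (sym (succPairs-∷ x xs))
          (∈-++⁺ʳ (consecutive (x ∷ xs)) (here refl))

  MapsTo-cases : ∀ {x xs a b} → MapsTo (x ∷ xs) a b →
                 (a , b) ∈ consecutive (x ∷ xs) ⊎ (a ≡ lastOr x xs × b ≡ x)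
  MapsTo-cases {x} {xs} m with ∈-++⁻ (consecutive (x ∷ xs)) (subst (_ ∈_) (succPairs-∷ x xs) m)
  ... | inj₁ p           = inj₁ p
  ... | inj₂ (here refl) = inj₂ (refl , refl)

  lastOr-∈ : ∀ x xs → lastOr x xs ∈ x ∷ xs
  lastOr-∈ x []       = here refl
  lastOr-∈ x (y ∷ ys) = there (lastOr-∈ y ys)

  lastOr-≢ : ∀ {x y ys} → Unique (x ∷ y ∷ ys) → lastOr y ys ≢ x
  lastOr-≢ {y = y} {ys} u refl = Unique[x∷xs]⇒x∉xs u (lastOr-∈ y ys)

  consecutive-∈ˡ : ∀ {L a b} → (a , b) ∈ consecutive L → a ∈ L
  consecutive-∈ˡ {_ ∷ _ ∷ _} (here refl) = here refl
  consecutive-∈ˡ {_ ∷ _ ∷ _} (there p)   = there (consecutive-∈ˡ p)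

  consecutive-∈ʳ : ∀ {x xs a b} → (a , b) ∈ consecutive (x ∷ xs) → b ∈ xs
  consecutive-∈ʳ {xs = _ ∷ _} (here refl) = here refl
  consecutive-∈ʳ {xs = _ ∷ _} (there p)   = there (consecutive-∈ʳ p)

  consecutive-pred : ∀ {x xs b} → b ∈ xs → ∃[ a ] (a , b) ∈ consecutive (x ∷ xs)
  consecutive-pred {x} {_ ∷ _} (here refl) = x , here refl
  consecutive-pred {x} {_ ∷ _} (there p)   with consecutive-pred p
  ... | a , q = a , there q

  consecutive-irrefl : ∀ {L a b} → Unique L → (a , b) ∈ consecutive L → a ≢ b
  consecutive-irrefl {_ ∷ _ ∷ _} u (here refl) refl = Unique[x∷xs]⇒x∉xs u (here refl)
  consecutive-irrefl {_ ∷ _ ∷ _} (_ ∷ u) (there p) = consecutive-irrefl u p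

  consecutive-asym : ∀ {L a b} → Unique L → (a , b) ∈ consecutive L → (b , a) ∉ consecutive L
  consecutive-asym {_ ∷ _ ∷ _} u (here refl) (here refl) = Unique[x∷xs]⇒x∉xs u (here refl)
  consecutive-asym {_ ∷ _ ∷ _} u (here refl) (there q)   =
    Unique[x∷xs]⇒x∉xs u (there (consecutive-∈ʳ q))
  consecutive-asym {_ ∷ _ ∷ _} u (there p)   (here refl) =
    Unique[x∷xs]⇒x∉xs u (there (consecutive-∈ʳ p))
  consecutive-asym {_ ∷ _ ∷ _} (_ ∷ u) (there p) (there q) = consecutive-asym u p q

  consecutive-head : ∀ {x y ys w} → Unique (x ∷ y ∷ ys) → (x , w) ∈ consecutive (x ∷ y ∷ ys) → w ≡ y
  consecutive-head u (here refl) = refl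
  consecutive-head u (there p)   = ⊥-elim (Unique[x∷xs]⇒x∉xs u (consecutive-∈ˡ p))

  MapsTo⇒∈ : ∀ (C : List A) {a b} → MapsTo C a b → a ∈ C × b ∈ C
  MapsTo⇒∈ (x ∷ xs) m with MapsTo-cases m
  ... | inj₁ p             = consecutive-∈ˡ p , there (consecutive-∈ʳ p)
  ... | inj₂ (refl , refl) = lastOr-∈ x xs , here refl

  ∈⇒predecessor : ∀ {C b} → b ∈ C → ∃[ a ] MapsTo C a b
  ∈⇒predecessor {x ∷ xs} (here refl) = lastOr x xs , MapsTo-lastOr
  ∈⇒predecessor {x ∷ xs} (there p)   with consecutive-pred p
  ... | a , q = a , consecutive⇒MapsTo q

  MapsTo-irrefl : ∀ {C a b} → Unique C → 2 ≤ length C → MapsTo C a b → a ≢ b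
  MapsTo-irrefl {_ ∷ []} u (s≤s ()) m
  MapsTo-irrefl {x ∷ y ∷ ys} u _ m with MapsTo-cases m
  ... | inj₁ p             = consecutive-irrefl u p
  ... | inj₂ (refl , refl) = lastOr-≢ u

  wrap-not-consecutive : ∀ {x y z zs} → Unique (x ∷ y ∷ z ∷ zs) →
                         (x , lastOr z zs) ∉ consecutive (x ∷ y ∷ z ∷ zs)
  wrap-not-consecutive {z = z} {zs} u@(_ ∷ u′) p with consecutive-head u p
  ... | refl = Unique[x∷xs]⇒x∉xs u′ (lastOr-∈ z zs)

  MapsTo-asym : ∀ {C a b} → Unique C → 3 ≤ length C → MapsTo C a b → ¬ MapsTo C b a
  MapsTo-asym {_ ∷ []}     _ (s≤s ())
  MapsTo-asym {_ ∷ _ ∷ []} _ (s≤s (s≤s ()))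
  MapsTo-asym {x ∷ y ∷ z ∷ zs} u _ m m′ with MapsTo-cases m | MapsTo-cases m′
  ... | inj₁ p             | inj₁ p′            = consecutive-asym u p p′
  ... | inj₁ p             | inj₂ (refl , refl) = wrap-not-consecutive u p
  ... | inj₂ (refl , refl) | inj₁ p′            = wrap-not-consecutive u p′
  ... | inj₂ (refl , refl) | inj₂ (refl , _)    = lastOr-≢ u refl

  module _ (S : A → Set) where

    private
      reaches-head : ∀ {x xs} → (∀ {a c} → (a , c) ∈ consecutive (x ∷ xs) → S c → S a) →
                     ∀ {c} → c ∈ x ∷ xs → S c → S x
      reaches-head              closed (here refl) s = s
      reaches-head {xs = _ ∷ _} closed (there p)   s =
        closed (here refl) (reaches-head (closed ∘ there) p s)

      spreads-from-last : ∀ {x xs} → (∀ {a c} → (a , c) ∈ consecutive (x ∷ xs) → S c → S a) →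
                          S (lastOr x xs) → ∀ {c} → c ∈ x ∷ xs → S c
      spreads-from-last {xs = []}    closed s (here refl) = s
      spreads-from-last {xs = _ ∷ _} closed s (here refl) =
        closed (here refl) (spreads-from-last (closed ∘ there) s (here refl))
      spreads-from-last {xs = _ ∷ _} closed s (there p) = spreads-from-last (closed ∘ there) s p

    predecessor-closed⇒all : ∀ {C} → (∀ {a c} → MapsTo C a c → S c → S a) →
                             ∀ {z} → z ∈ C → S z → ∀ {c} → c ∈ C → S c
    predecessor-closed⇒all {_ ∷ _} closed z∈C s =
      spreads-from-last (closed ∘ consecutive⇒MapsTo)
        (closed MapsTo-lastOr (reaches-head (closed ∘ consecutive⇒MapsTo) z∈C s))

  length≡1⇒MapsTo-refl : ∀ (C : List A) {a b} → length C ≡ 1 → MapsTo C a b → a ≡ b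
  length≡1⇒MapsTo-refl (_ ∷ []) _ (here refl) = refl

  length≡2⇒MapsTo-sym : ∀ (C : List A) {a b} → length C ≡ 2 → MapsTo C a b → MapsTo C b a
  length≡2⇒MapsTo-sym (_ ∷ _ ∷ []) _ (here refl)         = there (here refl)
  length≡2⇒MapsTo-sym (_ ∷ _ ∷ []) _ (there (here refl)) = here refl

  Adjacent⇒∈ : ∀ (C : List A) {u v} → Adjacent C u v → u ∈ C
  Adjacent⇒∈ C (inj₁ m) = proj₁ (MapsTo⇒∈ C m)
  Adjacent⇒∈ C (inj₂ m) = proj₂ (MapsTo⇒∈ C m)

  Adjacent-irrefl : ∀ {C u v} → Unique C → 2 ≤ length C → Adjacent C u v → u ≢ v
  Adjacent-irrefl u l (inj₁ m) = MapsTo-irrefl u l m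
  Adjacent-irrefl u l (inj₂ m) = MapsTo-irrefl u l m ∘ sym

  IsTransposition⇒length≡2 : ∀ {C : List A} {a b} → IsTransposition C a b → length C ≡ 2
  IsTransposition⇒length≡2 (inj₁ refl) = refl
  IsTransposition⇒length≡2 (inj₂ refl) = refl

  IsTransposition⇒Adjacent : ∀ {C : List A} {a b} → IsTransposition C a b → Adjacent C a b
  IsTransposition⇒Adjacent (inj₁ refl) = inj₁ (here refl)
  IsTransposition⇒Adjacent (inj₂ refl) = inj₂ (here refl)

  length≡2⇒Adjacent⇒MapsTo : ∀ (C : List A) {u v} → length C ≡ 2 → Adjacent C u v → MapsTo C u v
  length≡2⇒Adjacent⇒MapsTo _ _ (inj₁ m) = m
  length≡2⇒Adjacent⇒MapsTo C l (inj₂ m) = length≡2⇒MapsTo-sym C l m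

  pair-successor≡predecessor : ∀ {u v a b p : A} →
                               MapsTo (u ∷ v ∷ []) a b → MapsTo (u ∷ v ∷ []) p a → b ≡ p
  pair-successor≡predecessor (here refl)         (here refl)         = refl
  pair-successor≡predecessor (here refl)         (there (here refl)) = refl
  pair-successor≡predecessor (there (here refl)) (here refl)         = refl
  pair-successor≡predecessor (there (here refl)) (there (here refl)) = refl

module _ {B : Set} {P : B → Set} (P? : Decidable P) where

  count : List B → ℕ
  count xs = length (filter P? xs)

  count-++ : ∀ xs ys → count (xs ++ ys) ≡ count xs + count ys
  count-++ xs ys = trans (cong length (filter-++ P? xs ys)) (length-++ (filter P? xs))

  count-↭ : ∀ {xs ys} → xs ↭ ys → count xs ≡ count ys
  count-↭ = ↭-length ∘ filter-↭ P?

  count-∷-≤ : ∀ x xs → count xs ≤ count (x ∷ xs)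
  count-∷-≤ x xs = subst (count xs ≤_) (sym (count-++ [ x ] xs)) (m≤n+m (count xs) (count [ x ]))

  count-≥1 : ∀ {x xs} → x ∈ xs → P x → 1 ≤ count xs
  count-≥1 x∈xs px = filter-some P? (lose x∈xs px)

  count-≡0 : ∀ {xs} → (∀ {x} → x ∈ xs → ¬ P x) → count xs ≡ 0
  count-≡0 none = cong length (filter-none P? (All.tabulate none))

  count-∷-≥2 : ∀ {x y xs} → P x → y ∈ xs → P y → 2 ≤ count (x ∷ xs)
  count-∷-≥2 px y∈xs py =
    subst (2 ≤_) (sym (cong length (filter-accept P? px))) (s≤s (count-≥1 y∈xs py))

  count-≥2 : ∀ {x y xs} → x ∈ xs → y ∈ xs → x ≢ y → P x → P y → 2 ≤ count xs
  count-≥2 (here refl) (here refl) x≢y _  _  = ⊥-elim (x≢y refl)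
  count-≥2 (here refl) (there q)   _   px py = count-∷-≥2 px q py
  count-≥2 (there p)   (here refl) _   px py = count-∷-≥2 py p px
  count-≥2 {xs = z ∷ zs} (there p) (there q) x≢y px py =
    ≤-trans (count-≥2 p q x≢y px py) (count-∷-≤ z zs)

  count-[]≤1 : ∀ x → count [ x ] ≤ 1
  count-[]≤1 x = length-filter P? [ x ]

  count-[]≡1 : ∀ {x} → P x → count [ x ] ≡ 1
  count-[]≡1 px = cong length (filter-accept P? px)

  count-[]≡0 : ∀ {x} → ¬ P x → count [ x ] ≡ 0
  count-[]≡0 ¬px = cong length (filter-reject P? ¬px)

  count-[]-cong : ∀ {x y} → (P x → P y) → (P y → P x) → count [ x ] ≡ count [ y ]
  count-[]-cong {x} {y} to from = by-cases (P? x)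
    where
      by-cases : Dec (P x) → count [ x ] ≡ count [ y ]
      by-cases (yes px) = trans (count-[]≡1 px) (sym (count-[]≡1 (to px)))
      by-cases (no ¬px) = trans (count-[]≡0 ¬px) (sym (count-[]≡0 (¬px ∘ from)))

count-mono : ∀ {B : Set} {P Q : B → Set} (P? : Decidable P) (Q? : Decidable Q) →
             (∀ {x} → P x → Q x) → ∀ xs → count P? xs ≤ count Q? xs
count-mono P? Q? P⇒Q []       = z≤n
count-mono P? Q? P⇒Q (x ∷ xs) with P? x | Q? x
... | yes _  | yes _  = s≤s (count-mono P? Q? P⇒Q xs)
... | yes px | no ¬qx = ⊥-elim (¬qx (P⇒Q px))
... | no _   | yes _  = ≤-trans (count-mono P? Q? P⇒Q xs) (n≤1+n _)
... | no _   | no _   = count-mono P? Q? P⇒Q xs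

module _ {B : Set} where

  removeAt-↭ : ∀ (xs : List B) i → xs ↭ lookup xs i ∷ removeAt xs i
  removeAt-↭ (x ∷ xs) zero    = ↭-refl
  removeAt-↭ (x ∷ xs) (suc i) = ↭-trans (↭-prep x (removeAt-↭ xs i)) (↭-swap x _ ↭-refl)

  module _ {R : B → B → Set} (R-sym : Symmetric R) where

    AllPairs-resp-↭ : ∀ {xs ys} → xs ↭ ys → AllPairs R xs → AllPairs R ys
    AllPairs-resp-↭ ↭.refl         rs                  = rs
    AllPairs-resp-↭ (↭.prep x p)   (r ∷ rs)            = All-resp-↭ p r ∷ AllPairs-resp-↭ p rs
    AllPairs-resp-↭ (↭.swap x y p) ((rxy ∷ rx) ∷ ry ∷ rs) =
      (R-sym rxy ∷ All-resp-↭ p ry) ∷ All-resp-↭ p rx ∷ AllPairs-resp-↭ p rs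
    AllPairs-resp-↭ (↭.trans p q)  rs                  = AllPairs-resp-↭ q (AllPairs-resp-↭ p rs)

    AllPairs⇒lookup : ∀ {xs} → AllPairs R xs → ∀ i j → i ≢ j → R (lookup xs i) (lookup xs j)
    AllPairs⇒lookup (r ∷ rs) zero    zero    i≢j = ⊥-elim (i≢j refl)
    AllPairs⇒lookup (r ∷ rs) zero    (suc j) _   = All.lookup r (∈-lookup j)
    AllPairs⇒lookup (r ∷ rs) (suc i) zero    _   = R-sym (All.lookup r (∈-lookup i))
    AllPairs⇒lookup (r ∷ rs) (suc i) (suc j) i≢j = AllPairs⇒lookup rs i j (i≢j ∘ cong suc)

  lookup⇒AllPairs : ∀ {R : B → B → Set} xs →
                    (∀ i j → i ≢ j → R (lookup xs i) (lookup xs j)) → AllPairs R xs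
  lookup⇒AllPairs {R} xs related =
    subst (AllPairs R) (tabulate-lookup xs) (AllPairs.tabulate⁺ (related _ _))

private
  halve : ∀ {k m} → 2 + k ≡ 2 * suc m → k ≡ 2 * m
  halve {m = m} e = suc-injective (suc-injective (trans e (*-suc 2 m)))

  one-odd : ∀ m → 1 ≢ 2 * m
  one-odd zero    ()
  one-odd (suc m) e with () ← suc-injective (trans e (*-suc 2 m))

even-positive⇒≥2 : ∀ {k m} → 1 ≤ k → k ≡ 2 * m → 2 ≤ k
even-positive⇒≥2 {suc zero}    {m} _ e = ⊥-elim (one-odd m e)
even-positive⇒≥2 {suc (suc k)}     _ _ = s≤s (s≤s z≤n)

module _ {A : Set} where

  -- The helpers behind pairsB are private to Defs, hence this normal form.
  pairsB-∷ : ∀ (x : A) xs → pairsB (x ∷ xs) ≡ (x ∷ lastOr x xs ∷ []) ∷ pairsA (dropLast xs)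
  pairsB-∷ x []               = refl
  pairsB-∷ x (_ ∷ [])         = refl
  pairsB-∷ x (_ ∷ _ ∷ [])     = refl
  pairsB-∷ x (y ∷ z ∷ w ∷ ws) = cong (insert-second (y ∷ z ∷ [])) (pairsB-∷ x (w ∷ ws))
    where
      insert-second : List A → List (List A) → List (List A)
      insert-second Q []       = []
      insert-second Q (H ∷ Hs) = H ∷ Q ∷ Hs

  dropLast-++-lastOr : ∀ (y : A) ys → y ∷ ys ≡ dropLast (y ∷ ys) ++ [ lastOr y ys ]
  dropLast-++-lastOr y []       = refl
  dropLast-++-lastOr y (z ∷ zs) = cong (y ∷_) (dropLast-++-lastOr z zs)

  consecutive-dropLast : ∀ {L : List A} {a b} →
                         (a , b) ∈ consecutive (dropLast L) → (a , b) ∈ consecutive L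
  consecutive-dropLast {_ ∷ _ ∷ _ ∷ _} (here refl) = here refl
  consecutive-dropLast {_ ∷ _ ∷ _ ∷ _} (there p)   = there (consecutive-dropLast p)

  pairsA-consecutive : ∀ {L : List A} {Q} → Q ∈ pairsA L →
                       ∃[ u ] ∃[ v ] Q ≡ u ∷ v ∷ [] × (u , v) ∈ consecutive L
  pairsA-consecutive {x ∷ y ∷ zs} (here refl) = x , y , refl , here refl
  pairsA-consecutive {x ∷ y ∷ z ∷ zs} (there p) with pairsA-consecutive p
  ... | u , v , Q≡uv , uv∈zs = u , v , Q≡uv , there (there uv∈zs)

  lastOr-∷-dropLast-↭ : ∀ (y : A) ys → lastOr y ys ∷ dropLast (y ∷ ys) ↭ y ∷ ys
  lastOr-∷-dropLast-↭ y ys =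
    ↭-trans (∷↭∷ʳ (lastOr y ys) (dropLast (y ∷ ys))) (↭-reflexive (sym (dropLast-++-lastOr y ys)))

  pairsA-adjacent : ∀ {C : List A} {Q} → Q ∈ pairsA C →
                    ∃[ u ] ∃[ v ] Q ≡ u ∷ v ∷ [] × Adjacent C u v
  pairsA-adjacent {x ∷ xs} Q∈ with pairsA-consecutive Q∈
  ... | u , v , Q≡uv , uv∈ = u , v , Q≡uv , inj₁ (consecutive⇒MapsTo uv∈)

  pairsB-adjacent : ∀ {C : List A} {Q} → Q ∈ pairsB C →
                    ∃[ u ] ∃[ v ] Q ≡ u ∷ v ∷ [] × Adjacent C u v
  pairsB-adjacent {x ∷ xs} {Q} Q∈ with subst (Q ∈_) (pairsB-∷ x xs) Q∈
  ... | here refl = x , lastOr x xs , refl , inj₂ MapsTo-lastOr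
  ... | there Q∈′ with pairsA-consecutive Q∈′
  ...   | u , v , Q≡uv , uv∈ =
    u , v , Q≡uv , inj₁ (consecutive⇒MapsTo (consecutive-∷⁺ xs (consecutive-dropLast uv∈)))
    where
      consecutive-∷⁺ : ∀ xs → (u , v) ∈ consecutive xs → (u , v) ∈ consecutive (x ∷ xs)
      consecutive-∷⁺ (_ ∷ _) = there

  length≡2⇒∈pairsA : ∀ {C : List A} → length C ≡ 2 → C ∈ pairsA C
  length≡2⇒∈pairsA {_ ∷ _ ∷ []} _ = here refl

  length≡2⇒∈pairsB : ∀ {C : List A} → length C ≡ 2 → C ∈ pairsB C
  length≡2⇒∈pairsB {_ ∷ _ ∷ []} _ = here refl

-- Structure of a GSP

length-cases : ∀ {k} → 1 ≤ k → k ≡ 1 ⊎ k ≡ 2 ⊎ 3 ≤ k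
length-cases {1}                 _ = inj₁ refl
length-cases {2}                 _ = inj₂ (inj₁ refl)
length-cases {suc (suc (suc k))} _ = inj₂ (inj₂ (s≤s (s≤s (s≤s z≤n))))

module _ (I : SFInstance) where
  open SFInstance I

  member? : (a : Fin n) (C : Cycle I) → Dec (a ∈ C)
  member? a C = DecMem._∈?_ _≟ᶠ_ a C

  maps? : (a b : Fin n) (C : Cycle I) → Dec (MapsTo C a b)
  maps? a b C = DecMem._∈?_ (≡-dec _≟ᶠ_ _≟ᶠ_) (a , b) (succPairs C)

  Apart : Cycle I → Cycle I → Set
  Apart C D = (IsFixedPoint C × IsFixedPoint D) ⊎ DistinctCycles C D

  Apart-sym : Symmetric Apart
  Apart-sym (inj₁ (fpC , fpD))           = inj₁ (fpD , fpC)
  Apart-sym (inj₂ (a , b , inj₁ differ)) = inj₂ (a , b , inj₂ differ)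
  Apart-sym (inj₂ (a , b , inj₂ differ)) = inj₂ (a , b , inj₁ differ)

  Apart⇒≢ : ∀ {C D} → 2 ≤ length C → Apart C D → C ≢ D
  Apart⇒≢ l (inj₁ (fpC , _)) refl = ≤⇒≯ (≤-reflexive fpC) l
  Apart⇒≢ l (inj₂ (_ , _ , inj₁ (m , ¬m))) refl = ¬m m
  Apart⇒≢ l (inj₂ (_ , _ , inj₂ (m , ¬m))) refl = ¬m m

  module Structure {Π : List (Cycle I)} (G : IsGSP I Π) where
    open IsGSP G

    unique : ∀ {C} → C ∈ Π → Unique C
    unique C∈Π = proj₂ (cycles _ C∈Π)

    transposition-owns-edge : ∀ {X Y u v} → X ∈ Π → Y ∈ Π → X ≢ Y → length X ≡ 2 →
                              Adjacent X u v → ¬ Adjacent Y u v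
    transposition-owns-edge {X} {Y} {u} {v} X∈Π Y∈Π X≢Y len₂ X-uv (inj₁ Y-uv) =
      ≤⇒≯ (F4 u v u≢v) (+-mono-≤ (count-≥2 (maps? u v) X∈Π Y∈Π X≢Y X-uv′ Y-uv)
                                 (count-≥1 (maps? v u) X∈Π (length≡2⇒MapsTo-sym X len₂ X-uv′)))
      where
        X-uv′ : MapsTo X u v
        X-uv′ = length≡2⇒Adjacent⇒MapsTo X len₂ X-uv
        u≢v : u ≢ v
        u≢v = Adjacent-irrefl (unique X∈Π) (≤-reflexive (sym len₂)) X-uv
    transposition-owns-edge {X} X∈Π Y∈Π X≢Y len₂ X-uv (inj₂ Y-vu) =
      transposition-owns-edge X∈Π Y∈Π X≢Y len₂ (Adjacent-sym X X-uv) (inj₁ Y-vu)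

    long-predecessor-not-preferred : ∀ {D₁ D₂ p q x} → D₁ ∈ Π → D₂ ∈ Π → 3 ≤ length D₁ →
                                     MapsTo D₁ p x → MapsTo D₂ q x → ¬ Prefers I x p q
    long-predecessor-not-preferred {D₁} {D₂} {p} {q} {x} D₁∈Π D₂∈Π l D₁-px D₂-qx x-p≻q
      with ∈⇒predecessor (proj₁ (MapsTo⇒∈ D₁ D₁-px))
    ... | p′ , D₁-p′p =
      F2 x p x≢p no-transposition
        ((D₂ , D₂∈Π , q , D₂-qx , x-p≻q) , (D₁ , D₁∈Π , p′ , D₁-p′p , p-x≻p′))
      where
        x≢p : x ≢ p
        x≢p = MapsTo-irrefl (unique D₁∈Π) (≤-trans (n≤1+n 2) l) D₁-px ∘ sym
        p-x≻p′ : Prefers I p x p′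
        p-x≻p′ with F1 D₁ D₁∈Π p x p′ D₁-px D₁-p′p
        ... | inj₁ x≻p′ = x≻p′
        ... | inj₂ x≡p′ =
          ⊥-elim (MapsTo-asym (unique D₁∈Π) l D₁-px (subst (λ y → MapsTo D₁ y p) (sym x≡p′) D₁-p′p))
        no-transposition : ∀ Q → Q ∈ Π → ¬ IsTransposition Q x p
        no-transposition Q Q∈Π t =
          transposition-owns-edge Q∈Π D₁∈Π Q≢D₁ (IsTransposition⇒length≡2 t)
            (IsTransposition⇒Adjacent t) (inj₂ D₁-px)
          where
            Q≢D₁ : Q ≢ D₁
            Q≢D₁ refl = ≤⇒≯ (≤-reflexive (IsTransposition⇒length≡2 t)) l

    long-predecessors-agree : ∀ {D₁ D₂ p q x} → D₁ ∈ Π → D₂ ∈ Π → 3 ≤ length D₁ → 3 ≤ length D₂ →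
                              MapsTo D₁ p x → MapsTo D₂ q x → p ≡ q
    long-predecessors-agree {p = p} {q} {x} D₁∈Π D₂∈Π l₁ l₂ D₁-px D₂-qx
      with <-cmp (rank x p) (rank x q)
    ... | tri< p≻q _ _ = ⊥-elim (long-predecessor-not-preferred D₁∈Π D₂∈Π l₁ D₁-px D₂-qx p≻q)
    ... | tri≈ _ p≈q _ = rank-inj x p≈q
    ... | tri> _ _ q≻p = ⊥-elim (long-predecessor-not-preferred D₂∈Π D₁∈Π l₂ D₂-qx D₁-px q≻p)

    long-cycles-share-edges : ∀ {X Y z a b} → X ∈ Π → Y ∈ Π → 3 ≤ length X → 3 ≤ length Y →
                              z ∈ X → z ∈ Y → MapsTo X a b → MapsTo Y a b
    long-cycles-share-edges {X} {Y} {b = b} X∈Π Y∈Π lX lY z∈X z∈Y X-ab =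
      let _ , Y-a′b = ∈⇒predecessor (X⊆Y (proj₂ (MapsTo⇒∈ X X-ab)))
      in subst (λ a′ → MapsTo Y a′ b) (sym (agree X-ab Y-a′b)) Y-a′b
      where
        agree : ∀ {p q c} → MapsTo X p c → MapsTo Y q c → p ≡ q
        agree = long-predecessors-agree X∈Π Y∈Π lX lY
        closed : ∀ {a c} → MapsTo X a c → c ∈ Y → a ∈ Y
        closed X-ac c∈Y with ∈⇒predecessor c∈Y
        ... | _ , Y-a′c = subst (_∈ Y) (sym (agree X-ac Y-a′c)) (proj₁ (MapsTo⇒∈ Y Y-a′c))
        X⊆Y : ∀ {c} → c ∈ X → c ∈ Y
        X⊆Y = predecessor-closed⇒all (_∈ Y) closed z∈X z∈Y

    long-cycles-not-apart : ∀ {X Y z} → X ∈ Π → Y ∈ Π → 3 ≤ length X → 3 ≤ length Y →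
                            z ∈ X → z ∈ Y → ¬ Apart X Y
    long-cycles-not-apart _ _ lX _ _ _ (inj₁ (fpX , _)) =
      ≤⇒≯ (≤-reflexive fpX) (≤-trans (n≤1+n 2) lX)
    long-cycles-not-apart X∈Π Y∈Π lX lY z∈X z∈Y (inj₂ (_ , _ , inj₁ (X-ab , ¬Y-ab))) =
      ¬Y-ab (long-cycles-share-edges X∈Π Y∈Π lX lY z∈X z∈Y X-ab)
    long-cycles-not-apart X∈Π Y∈Π lX lY z∈X z∈Y (inj₂ (_ , _ , inj₂ (Y-ab , ¬X-ab))) =
      ¬X-ab (long-cycles-share-edges Y∈Π X∈Π lY lX z∈Y z∈X Y-ab)

    edge-unused-elsewhere : ∀ {C D u v} → C ∈ Π → D ∈ Π → 2 ≤ length C → Apart C D →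
                            Adjacent C u v → ¬ MapsTo D u v
    edge-unused-elsewhere {C} {D} C∈Π D∈Π lC apart C-uv D-uv
      with length-cases (≤-trans (s≤s z≤n) lC) | length-cases (proj₁ (cycles D D∈Π))
    ... | inj₁ lC≡1 | _ = ≤⇒≯ (≤-reflexive lC≡1) lC
    ... | inj₂ (inj₁ lC≡2) | _ =
      transposition-owns-edge C∈Π D∈Π (Apart⇒≢ lC apart) lC≡2 C-uv (inj₁ D-uv)
    ... | inj₂ (inj₂ _) | inj₁ lD≡1 =
      Adjacent-irrefl (unique C∈Π) lC C-uv (length≡1⇒MapsTo-refl D lD≡1 D-uv)
    ... | inj₂ (inj₂ _) | inj₂ (inj₁ lD≡2) =
      transposition-owns-edge D∈Π C∈Π (Apart⇒≢ lC apart ∘ sym) lD≡2 (inj₁ D-uv) C-uv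
    ... | inj₂ (inj₂ l₃C) | inj₂ (inj₂ l₃D) =
      long-cycles-not-apart C∈Π D∈Π l₃C l₃D (Adjacent⇒∈ C C-uv) (proj₁ (MapsTo⇒∈ D D-uv)) apart

  -- Replacing a cycle by transpositions along its edges

  PrefersToPartner : List (Cycle I) → Agent I → Agent I → Set
  PrefersToPartner Π x y = ∃[ C ] (C ∈ Π) × ∃[ p ] (MapsTo C p x × Prefers I x y p)

  disjoint-pairs-apart : ∀ {L} → (∀ {Q} → Q ∈ L → ∃[ u ] ∃[ v ] Q ≡ u ∷ v ∷ []) →
                         (∀ a → occurrences I L a ≤ 1) → AllPairs Apart L
  disjoint-pairs-apart {[]}    _      _      = []
  disjoint-pairs-apart {Q ∷ L} isPair occ≤1 with isPair (here refl)
  ... | u , v , refl =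
    All.tabulate apart ∷ disjoint-pairs-apart (isPair ∘ there)
                           (λ a → ≤-trans (count-∷-≤ (member? a) Q L) (occ≤1 a))
    where
      apart : ∀ {Q′} → Q′ ∈ L → Apart (u ∷ v ∷ []) Q′
      apart Q′∈L = inj₂ (u , v , inj₁ (here refl , λ Q′-uv →
        ≤⇒≯ (occ≤1 u) (count-∷-≥2 (member? u) (here refl) Q′∈L (proj₁ (MapsTo⇒∈ _ Q′-uv)))))

  record IsPairing (C : Cycle I) (P : List (Cycle I)) : Set where
    field
      pair                : ∀ {Q} → Q ∈ P → ∃[ u ] ∃[ v ] Q ≡ u ∷ v ∷ [] × Adjacent C u v
      occurrences-≡       : ∀ a → occurrences I P a ≡ occurrences I [ C ] a
      keeps-transposition : length C ≡ 2 → C ∈ P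

  module Replacement {Π C R P} (G : IsGSP I Π) (split : Π ↭ C ∷ R) (lC : 2 ≤ length C)
                     (pairing : IsPairing C P) where
    open IsGSP G
    open IsPairing pairing
    open Structure G

    C∈Π : C ∈ Π
    C∈Π = ∈-resp-↭ (↭-sym split) (here refl)

    R⊆Π : ∀ {D} → D ∈ R → D ∈ Π
    R⊆Π = ∈-resp-↭ (↭-sym split) ∘ there

    count-split : ∀ {Pr : Cycle I → Set} (Pr? : Decidable Pr) →
                  count Pr? Π ≡ count Pr? [ C ] + count Pr? R
    count-split Pr? = trans (count-↭ Pr? split) (count-++ Pr? [ C ] R)

    C∷R-apart : AllPairs Apart (C ∷ R)
    C∷R-apart = AllPairs-resp-↭ (λ {C} {D} → Apart-sym {C} {D}) split (lookup⇒AllPairs Π distinct)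

    pair-edge : ∀ {Q a b} → Q ∈ P → MapsTo Q a b → Adjacent C a b
    pair-edge Q∈P Q-ab with pair Q∈P
    pair-edge Q∈P (here refl)         | _ , _ , refl , C-uv = C-uv
    pair-edge Q∈P (there (here refl)) | _ , _ , refl , C-uv = Adjacent-sym C C-uv

    edge-unused-in-R : ∀ {D u v} → D ∈ R → Adjacent C u v → ¬ MapsTo D u v
    edge-unused-in-R D∈R with C∷R-apart
    ... | C-apart ∷ _ = edge-unused-elsewhere C∈Π (R⊆Π D∈R) lC (All.lookup C-apart D∈R)

    occurrences-P≤1 : ∀ a → occurrences I P a ≤ 1
    occurrences-P≤1 a = subst (_≤ 1) (sym (occurrences-≡ a)) (count-[]≤1 (member? a) C)

    mapCount-P≤1 : ∀ a b → mapCount I P a b ≤ 1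
    mapCount-P≤1 a b =
      ≤-trans (count-mono (maps? a b) (member? a) (λ {Q} → proj₁ ∘ MapsTo⇒∈ Q) P) (occurrences-P≤1 a)

    -- A new partner p of x is a neighbour of x in C; if it is x's successor, then by (F1)
    -- x likes its predecessor in C no better than p.
    PrefersToPartner-R++P⇒Π : ∀ {x y} → PrefersToPartner (R ++ P) x y → PrefersToPartner Π x y
    PrefersToPartner-R++P⇒Π (Q , Q∈ , p , Q-px , x-y≻p) with ∈-++⁻ R Q∈
    ... | inj₁ Q∈R = Q , R⊆Π Q∈R , p , Q-px , x-y≻p
    ... | inj₂ Q∈P with pair-edge Q∈P Q-px
    ...   | inj₁ C-px = C , C∈Π , p , C-px , x-y≻p
    ...   | inj₂ C-xp with ∈⇒predecessor (proj₁ (MapsTo⇒∈ C C-xp))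
    ...     | q , C-qx with F1 C C∈Π _ p q C-xp C-qx
    ...       | inj₁ p≻q = C , C∈Π , q , C-qx , <-trans x-y≻p p≻q
    ...       | inj₂ p≡q = C , C∈Π , q , C-qx , subst (Prefers I _ _) p≡q x-y≻p

    private
      R-free : ∀ {a b} → Adjacent C a b → mapCount I (R ++ P) a b ≡ mapCount I P a b
      R-free {a} {b} C-ab =
        trans (count-++ (maps? a b) R P)
              (cong (_+ mapCount I P a b)
                    (count-≡0 (maps? a b) (λ D∈R → edge-unused-in-R D∈R C-ab)))

      P-free : ∀ {a b} → ¬ Adjacent C a b → mapCount I (R ++ P) a b ≡ mapCount I R a b
      P-free {a} {b} ¬C-ab =
        trans (count-++ (maps? a b) R P)
              (trans (cong (mapCount I R a b +_)
                           (count-≡0 (maps? a b) (λ Q∈P → ¬C-ab ∘ pair-edge Q∈P)))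
                     (+-identityʳ _))

      R≤Π : ∀ a b → mapCount I R a b ≤ mapCount I Π a b
      R≤Π a b = subst (_ ≤_) (sym (count-split (maps? a b))) (m≤n+m _ _)

      isPair : ∀ {Q} → Q ∈ P → ∃[ u ] ∃[ v ] Q ≡ u ∷ v ∷ []
      isPair Q∈P with pair Q∈P
      ... | u , v , Q≡uv , _ = u , v , Q≡uv

      R-P-apart : ∀ {D Q} → D ∈ R → Q ∈ P → Apart D Q
      R-P-apart D∈R Q∈P with pair Q∈P
      ... | u , v , refl , C-uv = inj₂ (u , v , inj₂ (here refl , edge-unused-in-R D∈R C-uv))

    cycles-R++P : ∀ Q → Q ∈ R ++ P → IsCycle Q
    cycles-R++P Q Q∈ with ∈-++⁻ R Q∈
    ... | inj₁ Q∈R = cycles Q (R⊆Π Q∈R)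
    ... | inj₂ Q∈P with pair Q∈P
    ...   | _ , _ , refl , C-uv = s≤s z≤n , (Adjacent-irrefl (unique C∈Π) lC C-uv ∷ []) ∷ [] ∷ []

    apart-R++P : AllPairs Apart (R ++ P)
    apart-R++P with C∷R-apart
    ... | _ ∷ R-apart =
      AllPairs.++⁺ R-apart (disjoint-pairs-apart isPair occurrences-P≤1)
                   (All.tabulate λ D∈R → All.tabulate (R-P-apart D∈R))

    F1-R++P : ∀ Q → Q ∈ R ++ P → ∀ a b p → MapsTo Q a b → MapsTo Q p a → PrefersEq I a b p
    F1-R++P Q Q∈ a b p Q-ab Q-pa with ∈-++⁻ R Q∈
    ... | inj₁ Q∈R = F1 Q (R⊆Π Q∈R) a b p Q-ab Q-pa
    ... | inj₂ Q∈P with pair Q∈P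
    ...   | _ , _ , refl , _ = inj₂ (pair-successor≡predecessor Q-ab Q-pa)

    no-transposition-R++P⇒Π : ∀ {i j} → (∀ Q → Q ∈ R ++ P → ¬ IsTransposition Q i j) →
                              ∀ Q → Q ∈ Π → ¬ IsTransposition Q i j
    no-transposition-R++P⇒Π none Q Q∈Π t with ∈-resp-↭ split Q∈Π
    ... | here refl = none C (∈-++⁺ʳ R (keeps-transposition (IsTransposition⇒length≡2 t))) t
    ... | there Q∈R = none Q (∈-++⁺ˡ Q∈R) t

    F3-R++P : ∀ a → occurrences I (R ++ P) a ≡ cap a
    F3-R++P a = begin
      occurrences I (R ++ P) a                  ≡⟨ count-++ (member? a) R P ⟩
      occurrences I R a + occurrences I P a     ≡⟨ cong (_ +_) (occurrences-≡ a) ⟩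
      occurrences I R a + occurrences I [ C ] a ≡⟨ +-comm (occurrences I R a) _ ⟩
      occurrences I [ C ] a + occurrences I R a ≡⟨ sym (count-split (member? a)) ⟩
      occurrences I Π a                         ≡⟨ F3 a ⟩
      cap a                                     ∎
      where open ≡-Reasoning

    F4-R++P : ∀ a b → a ≢ b → mapCount I (R ++ P) a b + mapCount I (R ++ P) b a ≤ 2
    F4-R++P a b a≢b with maps? a b C ⊎-dec maps? b a C
    ... | yes C-ab =
      subst (_≤ 2) (sym (cong₂ _+_ (R-free C-ab) (R-free (Adjacent-sym C C-ab))))
            (+-mono-≤ (mapCount-P≤1 a b) (mapCount-P≤1 b a))
    ... | no ¬C-ab =
      subst (_≤ 2) (sym (cong₂ _+_ (P-free ¬C-ab) (P-free (¬C-ab ∘ Adjacent-sym C))))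
            (≤-trans (+-mono-≤ (R≤Π a b) (R≤Π b a)) (F4 a b a≢b))

    replaced : IsGSP I (R ++ P)
    replaced = record
      { cycles   = cycles-R++P
      ; distinct = AllPairs⇒lookup (λ {C} {D} → Apart-sym {C} {D}) apart-R++P
      ; F1       = F1-R++P
      ; F2       = λ i j i≢j none (i-rival , j-rival) →
                     F2 i j i≢j (no-transposition-R++P⇒Π none)
                        (PrefersToPartner-R++P⇒Π i-rival , PrefersToPartner-R++P⇒Π j-rival)
      ; F3       = F3-R++P
      ; F4       = F4-R++P
      }

  occurrences-[]-++ : ∀ {a} (X Y : Cycle I) → (a ∈ X → a ∉ Y) →
                      occurrences I [ X ++ Y ] a ≡ occurrences I [ X ] a + occurrences I [ Y ] a
  occurrences-[]-++ {a} X Y disjoint = by-cases (member? a X) (member? a Y)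
    where
      occ : Cycle I → ℕ
      occ Z = occurrences I [ Z ] a
      in⇒1 : ∀ {Z} → a ∈ Z → occ Z ≡ 1
      in⇒1 = count-[]≡1 (member? a)
      out⇒0 : ∀ {Z} → a ∉ Z → occ Z ≡ 0
      out⇒0 = count-[]≡0 (member? a)
      by-cases : Dec (a ∈ X) → Dec (a ∈ Y) → occ (X ++ Y) ≡ occ X + occ Y
      by-cases (yes a∈X) (yes a∈Y) = ⊥-elim (disjoint a∈X a∈Y)
      by-cases (yes a∈X) (no a∉Y)  = trans (in⇒1 (∈-++⁺ˡ a∈X)) (sym (cong₂ _+_ (in⇒1 a∈X) (out⇒0 a∉Y)))
      by-cases (no a∉X)  (yes a∈Y) = trans (in⇒1 (∈-++⁺ʳ X a∈Y)) (sym (cong₂ _+_ (out⇒0 a∉X) (in⇒1 a∈Y)))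
      by-cases (no a∉X)  (no a∉Y)  =
        trans (out⇒0 ([ a∉X , a∉Y ]′ ∘ ∈-++⁻ X)) (sym (cong₂ _+_ (out⇒0 a∉X) (out⇒0 a∉Y)))

  occurrences-pairsA : ∀ m {L : Cycle I} → Unique L → length L ≡ 2 * m →
                       ∀ a → occurrences I (pairsA L) a ≡ occurrences I [ L ] a
  occurrences-pairsA zero    {[]}         _ _ a = refl
  occurrences-pairsA (suc m) {_ ∷ []}     _ e   = ⊥-elim (one-odd (suc m) e)
  occurrences-pairsA (suc m) {y ∷ z ∷ zs} u@(_ ∷ u′@(_ ∷ u-zs)) e a = begin
    occurrences I (pairsA (y ∷ z ∷ zs)) a
      ≡⟨ count-++ (member? a) [ y ∷ z ∷ [] ] (pairsA zs) ⟩
    occurrences I [ y ∷ z ∷ [] ] a + occurrences I (pairsA zs) a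
      ≡⟨ cong (_ +_) (occurrences-pairsA m u-zs (halve e) a) ⟩
    occurrences I [ y ∷ z ∷ [] ] a + occurrences I [ zs ] a
      ≡⟨ sym (occurrences-[]-++ (y ∷ z ∷ []) zs disjoint) ⟩
    occurrences I [ y ∷ z ∷ zs ] a
      ∎
    where
      open ≡-Reasoning
      disjoint : ∀ {b} → b ∈ y ∷ z ∷ [] → b ∉ zs
      disjoint (here refl)         = Unique[x∷xs]⇒x∉xs u ∘ there
      disjoint (there (here refl)) = Unique[x∷xs]⇒x∉xs u′

  occurrences-pairsB : ∀ m {C : Cycle I} → Unique C → length C ≡ 2 * m →
                       ∀ a → occurrences I (pairsB C) a ≡ occurrences I [ C ] a
  occurrences-pairsB m {[]}         _ _ a = refl
  occurrences-pairsB m {x ∷ []}     _ e   = ⊥-elim (one-odd m e)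
  occurrences-pairsB m {x ∷ y ∷ ys} u e a = begin
    occurrences I (pairsB (x ∷ y ∷ ys)) a
      ≡⟨ cong (λ P → occurrences I P a) (pairsB-∷ x (y ∷ ys)) ⟩
    occurrences I (pairsA C′) a
      ≡⟨ occurrences-pairsA m u′ (trans (↭-length C′↭C) e) a ⟩
    occurrences I [ C′ ] a
      ≡⟨ count-[]-cong (member? a) (∈-resp-↭ C′↭C) (∈-resp-↭ (↭-sym C′↭C)) ⟩
    occurrences I [ x ∷ y ∷ ys ] a
      ∎
    where
      open ≡-Reasoning
      C′ : Cycle I
      C′ = x ∷ lastOr y ys ∷ dropLast (y ∷ ys)
      C′↭C : C′ ↭ x ∷ y ∷ ys
      C′↭C = ↭-prep x (lastOr-∷-dropLast-↭ y ys)
      u′ : Unique C′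
      u′ = AllPairs-resp-↭ ≢-sym (↭-sym C′↭C) u

  pairsA-isPairing : ∀ m {C : Cycle I} → Unique C → length C ≡ 2 * m → IsPairing C (pairsA C)
  pairsA-isPairing m u e = record
    { pair                = pairsA-adjacent
    ; occurrences-≡       = occurrences-pairsA m u e
    ; keeps-transposition = length≡2⇒∈pairsA
    }

  pairsB-isPairing : ∀ m {C : Cycle I} → Unique C → length C ≡ 2 * m → IsPairing C (pairsB C)
  pairsB-isPairing m u e = record
    { pair                = pairsB-adjacent
    ; occurrences-≡       = occurrences-pairsB m u e
    ; keeps-transposition = length≡2⇒∈pairsB
    }

theorem11 : (I : SFInstance) (Π : List (Cycle I)) → IsGSP I Π →
    (r : Fin (length Π)) → (∃[ m ] length (lookup Π r) ≡ 2 * m) →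
    IsGSP I (removeAt Π r ++ pairsA (lookup Π r))
    × IsGSP I (removeAt Π r ++ pairsB (lookup Π r))
theorem11 I Π G r (m , even) =
  replaced (pairsA-isPairing I m unique even) , replaced (pairsB-isPairing I m unique even)
  where
    C : Cycle I
    C = lookup Π r
    nonempty : 1 ≤ length C
    nonempty = proj₁ (IsGSP.cycles G C (∈-lookup r))
    unique : Unique C
    unique = proj₂ (IsGSP.cycles G C (∈-lookup r))
    replaced : ∀ {P} → IsPairing I C P → IsGSP I (removeAt Π r ++ P)
    replaced = Replacement.replaced I G (removeAt-↭ Π r) (even-positive⇒≥2 {m = m} nonempty even)
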